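{- Let $c$ be a positive integer, and define the sequence $\{U_n\}_{n\geq 0}$ by $U_0=0$, $U_1=1$, and $U_{n+1}=cU_n+U_{n-1}$ for $n=1,2,3,\ldots$. Suppose that $n>0$ is an integer with $n\equiv 2 \pmod 4$ and $p$ is a prime divisor of $U_n$ which divides none of $U_1,\ldots,U_{n-1}$. Then $U_{kn+r}\equiv U_r \pmod p$ for all $k\in\{0,1,2,\ldots\}$ and all $r\in\{0,\ldots,n-1\}$. -}

module Defs where

open import Data.Nat using (ℕ; zero; suc; _+_; _*_)

U : ℕ → ℕ → ℕ
U c zero = 0
U c (suc zero) = 1
U c (suc (suc n)) = c * U c (suc n) + U c n

-- Write n = 2m with m odd. Since U (2m) = U m * (U (m + 1) + U (m - 1)) and p does not
-- divide U m, p divides U (m + 1) + U (m - 1). Cassini's identity for odd m,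
-- U (m - 1) * U (m + 1) + 1 = U m ^ 2, turns U (n - 1) = U m ^ 2 + U (m - 1) ^ 2 into
-- U (m - 1) * (U (m + 1) + U (m - 1)) + 1, so U (n - 1) ≡ 1 and U n ≡ 0 modulo p. The
-- addition formula U (n + x) = U (x + 1) * U n + U x * U (n - 1) then makes U periodic
-- modulo p with period n.
module Submission where

open import Defs
open import Data.Nat using (ℕ; zero; suc; _+_; _*_; _<_; _%_; _/_; _≤_; s≤s; z≤n; NonZero)
open import Data.Nat.Divisibility using (_∣_; ∣n⇒∣m*n)
open import Data.Nat.DivMod using (m≡m%n+[m/n]*n; %-distribˡ-*; %-remove-+ˡ)
open import Data.Nat.Primality using (Prime; prime⇒nonZero; euclidsLemma)
open import Data.Nat.Properties
  using (+-suc; +-comm; +-assoc; +-cancelʳ-≡; *-comm; *-zeroʳ; *-identityʳ; *-distribˡ-+; m≤m+n)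
open import Data.Nat.Tactic.RingSolver using (solve-∀)
open import Data.Product using (∃-syntax; _,_)
open import Data.Sum using (fromInj₂)
open import Function using (_∘_)
open import Relation.Binary.PropositionalEquality using (_≡_; refl; sym; trans; cong; cong₂; subst; module ≡-Reasoning)
open import Relation.Nullary using (¬_; contradiction)

open ≡-Reasoning

U-+ : ∀ c m n → U c (suc (m + n)) ≡ U c (suc m) * U c (suc n) + U c m * U c n
U-+ c zero n = sym (identity (U c (suc n)))
  where
  identity : ∀ x → 1 * x + 0 ≡ x
  identity = solve-∀
U-+ c (suc zero) n = sym (identity c (U c (suc n)) (U c n))
  where
  identity : ∀ c y₁ y₀ → (c * 1 + 0) * y₁ + 1 * y₀ ≡ c * y₁ + y₀
  identity = solve-∀
U-+ c (suc (suc m)) n = begin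
  c * U c (suc (suc m + n)) + U c (suc (m + n))
    ≡⟨ cong₂ (λ s t → c * s + t) (U-+ c (suc m) n) (U-+ c m n) ⟩
  c * (U c (2 + m) * U c (suc n) + U c (suc m) * U c n) + (U c (suc m) * U c (suc n) + U c m * U c n)
    ≡⟨ identity c (U c (2 + m)) (U c (suc m)) (U c m) (U c (suc n)) (U c n) ⟩
  U c (3 + m) * U c (suc n) + U c (2 + m) * U c n ∎
  where
  identity : ∀ c x₂ x₁ x₀ y₁ y₀ →
    c * (x₂ * y₁ + x₁ * y₀) + (x₁ * y₁ + x₀ * y₀) ≡ (c * x₂ + x₁) * y₁ + (c * x₁ + x₀) * y₀
  identity = solve-∀

U-double : ∀ c m → U c (2 + (m + m)) ≡ U c (suc m) * (U c (2 + m) + U c m)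
U-double c m = begin
  U c (2 + (m + m))                                     ≡⟨ cong (U c ∘ suc) (+-suc m m) ⟨
  U c (suc (m + suc m))                                 ≡⟨ U-+ c m (suc m) ⟩
  U c (suc m) * U c (2 + m) + U c m * U c (suc m)       ≡⟨ cong (U c (suc m) * U c (2 + m) +_) (*-comm (U c m) _) ⟩
  U c (suc m) * U c (2 + m) + U c (suc m) * U c m       ≡⟨ *-distribˡ-+ (U c (suc m)) _ _ ⟨
  U c (suc m) * (U c (2 + m) + U c m)                   ∎

-- Both sides are U (3 + 2m), split by the addition formula in two ways.
U-cassini-step : ∀ c m → U c (3 + m) * U c (suc m) + U c (2 + m) * U c m
                       ≡ U c (2 + m) * U c (2 + m) + U c (suc m) * U c (suc m)
U-cassini-step c m = begin
  U c (3 + m) * U c (suc m) + U c (2 + m) * U c m       ≡⟨ U-+ c (2 + m) m ⟨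
  U c (3 + (m + m))                                     ≡⟨ cong (U c ∘ suc ∘ suc) (+-suc m m) ⟨
  U c (suc (suc m + suc m))                             ≡⟨ U-+ c (suc m) (suc m) ⟩
  U c (2 + m) * U c (2 + m) + U c (suc m) * U c (suc m) ∎

w+u≡z+v⇒u+1≡v⇒w≡z+1 : ∀ {w u z v} → w + u ≡ z + v → u + 1 ≡ v → w ≡ z + 1
w+u≡z+v⇒u+1≡v⇒w≡z+1 {w} {u} {z} {v} w+u≡z+v u+1≡v = +-cancelʳ-≡ u w (z + 1) (begin
  w + u         ≡⟨ w+u≡z+v ⟩
  z + v         ≡⟨ cong (z +_) (trans (sym u+1≡v) (+-comm u 1)) ⟩
  z + (1 + u)   ≡⟨ +-assoc z 1 u ⟨
  z + 1 + u     ∎)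

w+u≡z+v⇒u≡v+1⇒w+1≡z : ∀ {w u z v} → w + u ≡ z + v → u ≡ v + 1 → w + 1 ≡ z
w+u≡z+v⇒u≡v+1⇒w+1≡z {w} {u} {z} {v} w+u≡z+v u≡v+1 = +-cancelʳ-≡ v (w + 1) z (begin
  w + 1 + v     ≡⟨ +-assoc w 1 v ⟩
  w + (1 + v)   ≡⟨ cong (w +_) (trans (+-comm 1 v) (sym u≡v+1)) ⟩
  w + u         ≡⟨ w+u≡z+v ⟩
  z + v         ∎)

U-cassini-even : ∀ c i → U c (2 + (i + i)) * U c (i + i) + 1 ≡ U c (suc (i + i)) * U c (suc (i + i))
U-cassini-odd  : ∀ c i → U c (3 + (i + i)) * U c (suc (i + i)) ≡ U c (2 + (i + i)) * U c (2 + (i + i)) + 1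

U-cassini-even c zero = cong (_+ 1) (*-zeroʳ (U c 2))
U-cassini-even c (suc i) rewrite +-suc i i =
  w+u≡z+v⇒u≡v+1⇒w+1≡z (U-cassini-step c (suc (i + i))) (U-cassini-odd c i)
U-cassini-odd c i = w+u≡z+v⇒u+1≡v⇒w≡z+1 (U-cassini-step c (i + i)) (U-cassini-even c i)

U-suc-double-even : ∀ c i → let a = i + i in U c (suc (a + a)) ≡ U c a * (U c (2 + a) + U c a) + 1
U-suc-double-even c i = begin
  U c (suc (a + a))                         ≡⟨ U-+ c a a ⟩
  U c (suc a) * U c (suc a) + U c a * U c a ≡⟨ cong (_+ U c a * U c a) (U-cassini-even c i) ⟨
  U c (2 + a) * U c a + 1 + U c a * U c a   ≡⟨ identity (U c (2 + a)) (U c a) ⟩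
  U c a * (U c (2 + a) + U c a) + 1         ∎
  where
  a = i + i
  identity : ∀ x y → x * y + 1 + y * y ≡ y * (x + y) + 1
  identity = solve-∀

module _ (c p : ℕ) .{{_ : NonZero p}} (b : ℕ) (p∣U[1+b] : p ∣ U c (suc b)) (U[b]≡1 : U c b % p ≡ 1 % p) where

  U-shift-mod : ∀ x → U c (suc b + x) % p ≡ U c x % p
  U-shift-mod x = begin
    U c (suc b + x) % p                             ≡⟨ cong (λ t → U c (suc t) % p) (+-comm b x) ⟩
    U c (suc (x + b)) % p                           ≡⟨ cong (_% p) (U-+ c x b) ⟩
    (U c (suc x) * U c (suc b) + U c x * U c b) % p ≡⟨ %-remove-+ˡ (U c x * U c b) (∣n⇒∣m*n (U c (suc x)) p∣U[1+b]) ⟩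
    (U c x * U c b) % p                             ≡⟨ %-distribˡ-* (U c x) (U c b) p ⟩
    (U c x % p * (U c b % p)) % p                   ≡⟨ cong (λ t → (U c x % p * t) % p) U[b]≡1 ⟩
    (U c x % p * (1 % p)) % p                       ≡⟨ %-distribˡ-* (U c x) 1 p ⟨
    (U c x * 1) % p                                 ≡⟨ cong (_% p) (*-identityʳ (U c x)) ⟩
    U c x % p                                       ∎

  U-periodic-mod : ∀ k x → U c (k * suc b + x) % p ≡ U c x % p
  U-periodic-mod zero    x = refl
  U-periodic-mod (suc k) x = begin
    U c (suc b + k * suc b + x) % p   ≡⟨ cong (λ t → U c t % p) (+-assoc (suc b) (k * suc b) x) ⟩
    U c (suc b + (k * suc b + x)) % p ≡⟨ U-shift-mod (k * suc b + x) ⟩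
    U c (k * suc b + x) % p           ≡⟨ U-periodic-mod k x ⟩
    U c x % p                         ∎

n%4≡2⇒n≡2+4i : ∀ n → n % 4 ≡ 2 → ∃[ i ] n ≡ 2 + ((i + i) + (i + i))
n%4≡2⇒n≡2+4i n n%4≡2 = n / 4 , (begin
  n                 ≡⟨ m≡m%n+[m/n]*n n 4 ⟩
  n % 4 + n / 4 * 4 ≡⟨ cong (_+ n / 4 * 4) n%4≡2 ⟩
  2 + n / 4 * 4     ≡⟨ cong (2 +_) (identity (n / 4)) ⟩
  2 + ((n / 4 + n / 4) + (n / 4 + n / 4)) ∎)
  where
  identity : ∀ i → i * 4 ≡ (i + i) + (i + i)
  identity = solve-∀

lemma4p1 : (c n p : ℕ) → 0 < c → 0 < n → n % 4 ≡ 2 → (pp : Prime p) → p ∣ U c n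
         → (∀ m → 1 ≤ m → m < n → ¬ (p ∣ U c m))
         → ∀ (k r : ℕ) → r < n
         → _%_ (U c (k * n + r)) p {{prime⇒nonZero pp}} ≡ _%_ (U c r) p {{prime⇒nonZero pp}}
lemma4p1 c n p _ _ n%4≡2 pp p∣Uₙ minimal k r _ with n%4≡2⇒n≡2+4i n n%4≡2
... | i , refl = U-periodic-mod c p (suc (a + a)) p∣Uₙ U[1+2a]≡1 k r
  where
  instance
    p≢0 : NonZero p
    p≢0 = prime⇒nonZero pp
  a = i + i
  p∤U[1+a] : ¬ p ∣ U c (suc a)
  p∤U[1+a] = minimal (suc a) (s≤s z≤n) (s≤s (s≤s (m≤m+n a a)))
  p∣U[2+a]+U[a] : p ∣ U c (2 + a) + U c a
  p∣U[2+a]+U[a] = fromInj₂ (λ p∣U[1+a] → contradiction p∣U[1+a] p∤U[1+a])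
    (euclidsLemma (U c (suc a)) _ pp (subst (p ∣_) (U-double c a) p∣Uₙ))
  U[1+2a]≡1 : U c (suc (a + a)) % p ≡ 1 % p
  U[1+2a]≡1 = trans (cong (_% p) (U-suc-double-even c i)) (%-remove-+ˡ 1 (∣n⇒∣m*n (U c a) p∣U[2+a]+U[a]))
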